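{- A relation $\phi\subseteq A\times A$ is normal iff for every set $X$ and every pair of functions $f,g\colon A\to X$, $\phi\le g^\circ\cdot f$ implies $f=g$.
   Context: Relations are composed applicatively, $^\circ$ is converse, functions are regarded as relations; $\phi\le g^\circ\cdot f$ means $a\,\phi\,b\Rightarrow f(a)=g(b)$. An endorelation $\phi\subseteq A\times A$ is normal if its difunctional closure (least relation of the form $g^\circ\cdot f$ containing it) is reflexive, i.e. every $a\in A$ is connected to itself by a chain $a\,\phi\,x_1\,\phi^\circ\,x_2\,\phi\cdots\phi^\circ\,x_{n-1}\,\phi\,a$ of alternating $\phi$- and $\phi^\circ$-steps. -}

module Defs where

open import Level using (Level; _⊔_)
open import Relation.Binary.Core using (Rel)
open import Relation.Binary.Bundles using (Setoid)

-- Zigzag φ a b : there is a chain  a φ x₁ φ° x₂ φ ⋯ φ° xₙ₋₁ φ b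
-- of alternating φ- and φ°-steps, starting and ending with a φ-step.
-- This is (membership in) the difunctional closure of φ.
data Zigzag {a ℓ} {A : Set a} (φ : Rel A ℓ) : Rel A (a ⊔ ℓ) where
  single : ∀ {x y} → φ x y → Zigzag φ x y
  extend : ∀ {x y z w} → Zigzag φ x y → φ z y → φ z w → Zigzag φ x w

Normal : ∀ {a ℓ} {A : Set a} → Rel A ℓ → Set (a ⊔ ℓ)
Normal {A = A} φ = ∀ (x : A) → Zigzag φ x x

Below : ∀ {a ℓ c e} {A : Set a} (φ : Rel A ℓ) (X : Setoid c e) →
        (f g : A → Setoid.Carrier X) → Set (a ⊔ ℓ ⊔ e)
Below φ X f g = ∀ {x y} → φ x y → Setoid._≈_ X (f x) (g y)

Equal : ∀ {a c e} {A : Set a} (X : Setoid c e) →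
        (f g : A → Setoid.Carrier X) → Set (a ⊔ e)
Equal X f g = ∀ x → Setoid._≈_ X (f x) (g x)

-- A zigzag from x to y forces f x ≈ g y whenever φ ≤ g°·f, which gives one
-- direction. Conversely, let X be A ⊎ A (a left and a right copy of A) modulo
-- the equivalence relation generated by the edges inj₁ x — inj₂ y for φ x y,
-- with f = inj₁ and g = inj₂; then φ ≤ g°·f holds by construction. Paths in
-- this bipartite graph alternate between the two copies, so a path from inj₁ x
-- to inj₂ y is exactly a zigzag from x to y, and f = g makes φ normal.
module Submission where

open import Defs
open import Level using (Level; _⊔_; Lift; lift; lower)
open import Relation.Binary.Core using (Rel)
open import Relation.Binary.Bundles using (Setoid)
open import Relation.Binary.PropositionalEquality using (_≡_; refl)
open import Relation.Binary.Construct.Closure.Symmetric using (SymClosure; fwd; bwd)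
open import Relation.Binary.Construct.Closure.ReflexiveTransitive using (Star; ε; _◅_)
open import Relation.Binary.Construct.Closure.Equivalence as EqClosure using (EqClosure)
open import Relation.Unary using (Pred)
open import Data.Sum using (_⊎_; inj₁; inj₂)
open import Data.Product using (∃-syntax; _×_; _,_)
open import Function.Base using (_∘_)
open import Function.Bundles using (_⇔_; mk⇔)

private
  variable
    a ℓ c e : Level
    A : Set a

Setoid-lift : ∀ c′ e′ → Setoid c e → Setoid (c ⊔ c′) (e ⊔ e′)
Setoid-lift c′ e′ S = record
  { Carrier       = Lift c′ S.Carrier
  ; _≈_           = λ u v → Lift e′ (lower u S.≈ lower v)
  ; isEquivalence = record
    { refl  = lift S.refl
    ; sym   = λ p → lift (S.sym (lower p))
    ; trans = λ p q → lift (S.trans (lower p) (lower q))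
    }
  }
  where module S = Setoid S

Star-preserves : ∀ {t p} {T : Rel A t} {P : Pred A p} →
                 (∀ {u v} → P u → T u v → P v) → ∀ {u v} → P u → Star T u v → P v
Star-preserves step p ε        = p
Star-preserves step p (t ◅ ts) = Star-preserves step (step p t) ts

Below⇒Zigzag⇒≈ : (φ : Rel A ℓ) (X : Setoid c e) {f g : A → Setoid.Carrier X} →
                  Below φ X f g → ∀ {x y} → Zigzag φ x y → Setoid._≈_ X (f x) (g y)
Below⇒Zigzag⇒≈ φ X below (single xφy)       = below xφy
Below⇒Zigzag⇒≈ φ X below (extend p zφy zφw) =
  X.trans (Below⇒Zigzag⇒≈ φ X below p) (X.trans (X.sym (below zφy)) (below zφw))
  where module X = Setoid X

module _ {A : Set a} (φ : Rel A ℓ) where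

  data Edge : Rel (A ⊎ A) (a ⊔ ℓ) where
    edge : ∀ {x y} → φ x y → Edge (inj₁ x) (inj₂ y)

  ZigzagFrom : A → Pred (A ⊎ A) (a ⊔ ℓ)
  ZigzagFrom x (inj₁ x′) = Lift ℓ (x ≡ x′) ⊎ ∃[ y ] Zigzag φ x y × φ x′ y
  ZigzagFrom x (inj₂ y)  = Zigzag φ x y

  ZigzagFrom-step : ∀ {x u v} → ZigzagFrom x u → SymClosure Edge u v → ZigzagFrom x v
  ZigzagFrom-step (inj₁ (lift refl))    (fwd (edge xφy)) = single xφy
  ZigzagFrom-step (inj₂ (y , p , x′φy)) (fwd (edge x′φy′)) = extend p x′φy x′φy′
  ZigzagFrom-step p                     (bwd (edge x′φy)) = inj₂ (_ , p , x′φy)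

  EqClosure-Edge⇒Zigzag : ∀ {x y} → EqClosure Edge (inj₁ x) (inj₂ y) → Zigzag φ x y
  EqClosure-Edge⇒Zigzag = Star-preserves ZigzagFrom-step (inj₁ (lift refl))

proposition31 : ∀ {a ℓ} (c e : Level) {A : Set a} (φ : Rel A ℓ) →
    Normal φ ⇔ (∀ (X : Setoid (a ⊔ ℓ ⊔ c) (a ⊔ ℓ ⊔ e)) (f g : A → Setoid.Carrier X) →
                  Below φ X f g → Equal X f g)
proposition31 {a} {ℓ} c e {A} φ = mk⇔ normal⇒equal equal⇒normal
  where
  normal⇒equal : Normal φ → ∀ X f g → Below φ X f g → Equal X f g
  normal⇒equal normal X f g below x = Below⇒Zigzag⇒≈ φ X below (normal x)

  equal⇒normal : (∀ X f g → Below φ X f g → Equal X f g) → Normal φ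
  equal⇒normal equal x = EqClosure-Edge⇒Zigzag φ (lower (equal X f g edges x))
    where
    X : Setoid (a ⊔ ℓ ⊔ c) (a ⊔ ℓ ⊔ e)
    X = Setoid-lift (ℓ ⊔ c) e (EqClosure.setoid (Edge φ))
    f g : A → Setoid.Carrier X
    f = lift ∘ inj₁
    g = lift ∘ inj₂
    edges : Below φ X f g
    edges xφy = lift (EqClosure.return (edge xφy))
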